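{- Let $k\ge 0$ be an integer, let $G$ be any connected graph on $k+1$ vertices, and let $S_k$ be the star graph with $k$ edges (one center vertex adjacent to $k$ leaves). Then for every graph $H$, \[ \sharp\operatorname{hom}(G,H)\le \sharp\operatorname{hom}(S_k,H). \]
   Context: All graphs are finite, simple and undirected. For graphs $G$ and $H$, $\operatorname{hom}(G,H)$ is the set of graph homomorphisms from $G$ to $H$, i.e. maps $f:V(G)\to V(H)$ such that $\{u,v\}\in E(G)$ implies $\{f(u),f(v)\}\in E(H)$, and $\sharp\operatorname{hom}(G,H)$ denotes its cardinality. -}

module Defs where

open import Data.Nat using (ℕ; zero; suc)
open import Data.Bool using (Bool; true; false; T; _∧_)
open import Data.Fin using (Fin; zero; suc)
open import Data.List using (List; []; _∷_; map; concatMap; filter; length)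
open import Data.Product using (_×_)
open import Relation.Binary.PropositionalEquality using (_≡_)
open import Relation.Nullary using (¬_)
open import Relation.Nullary.Decidable using (Dec; yes; no)
open import Data.Bool using (_≟_)

record Graph (n : ℕ) : Set where
  field
    adj   : Fin n → Fin n → Bool
    sym   : ∀ u v → adj u v ≡ adj v u
    irref : ∀ u → adj u u ≡ false
open Graph public

Edge : ∀ {n} → Graph n → Fin n → Fin n → Set
Edge G u v = T (adj G u v)

IsHom : ∀ {n m} → Graph n → Graph m → (Fin n → Fin m) → Set
IsHom G H f = ∀ u v → Edge G u v → Edge H (f u) (f v)

data Walk {n : ℕ} (G : Graph n) : Fin n → Fin n → Set where
  here : ∀ {u} → Walk G u u
  step : ∀ {u v w} → Edge G u v → Walk G v w → Walk G u w

Connected : ∀ {n} → Graph n → Set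
Connected G = ∀ u v → Walk G u v

allFins : (m : ℕ) → List (Fin m)
allFins zero    = []
allFins (suc m) = zero ∷ map suc (allFins m)

extend : ∀ {n m} → Fin m → (Fin n → Fin m) → Fin (suc n) → Fin m
extend a f zero    = a
extend a f (suc i) = f i

allMaps : (n m : ℕ) → List (Fin n → Fin m)
allMaps zero    m = (λ ()) ∷ []
allMaps (suc n) m = concatMap (λ a → map (extend a) (allMaps n m)) (allFins m)

allB : ∀ {n} → (Fin n → Bool) → Bool
allB {zero}  p = true
allB {suc n} p = p zero ∧ allB (λ i → p (suc i))

implB : Bool → Bool → Bool
implB false _ = true
implB true  b = b

isHomB : ∀ {n m} → Graph n → Graph m → (Fin n → Fin m) → Bool
isHomB G H f = allB (λ u → allB (λ v → implB (adj G u v) (adj H (f u) (f v))))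

homCount : ∀ {n m} → Graph n → Graph m → ℕ
homCount {n} {m} G H = length (filter (λ f → T? (isHomB G H f)) (allMaps n m))
  where
  T? : (b : Bool) → Dec (T b)
  T? true  = yes _
  T? false = no (λ ())

starAdj : ∀ {k} → Fin (suc k) → Fin (suc k) → Bool
starAdj zero    zero    = false
starAdj zero    (suc _) = true
starAdj (suc _) zero    = true
starAdj (suc _) (suc _) = false

Star : (k : ℕ) → Graph (suc k)
Star k = record { adj = starAdj ; sym = s ; irref = r }
  where
  s : ∀ u v → starAdj u v ≡ starAdj v u
  s zero    zero    = _≡_.refl
  s zero    (suc _) = _≡_.refl
  s (suc _) zero    = _≡_.refl
  s (suc _) (suc _) = _≡_.refl
  r : ∀ u → starAdj u u ≡ false
  r zero    = _≡_.refl
  r (suc _) = _≡_.refl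

-- Write deg for the degree in H and M(G, x, j) = Σ_{f ∈ hom(G,H)} deg(f x)^j. For every
-- connected G on k + 1 vertices and every vertex x, M(G, x, j) ≤ Σ_v deg(v)^(k+j); for j = 0
-- this is the theorem, as Σ_v deg(v)^k counts the homomorphisms from S_k (an image of the
-- centre, then one of its neighbours for each leaf). Remove a
-- vertex ℓ ≠ x as far as possible from x: G − ℓ is still connected, and ℓ has a neighbour p
-- closer to x. Summing out the image of ℓ, which must be adjacent to the image of p, gives
-- M(G, x, j) ≤ Σ_{g ∈ hom(G−ℓ,H)} deg(g x)^j deg(g p), and the weighted AM-GM inequality
-- (j+1) a^j b ≤ j a^(j+1) + b^(j+1) bounds j + 1 times this by
-- j M(G−ℓ, x, j+1) + M(G−ℓ, p, j+1), where induction applies.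

module Submission where

open import Defs hiding (sym)
open import Data.Bool using (Bool; true; false; T; _∧_)
open import Data.Bool.Properties using (T-∧)
open import Data.Fin using (Fin; zero; suc; punchIn; punchOut; _≟_)
open import Data.Fin.Properties
  using (any?; punchIn-punchOut; punchOut-punchIn; punchOut-cong; punchInᵢ≢i)
open import Data.List using (List; []; _∷_; _++_; map; concatMap; filter; length; allFin)
open import Data.List.Extrema.Nat using (argmax; f[xs]≤f[argmax])
open import Data.List.Membership.Propositional.Properties using (∈-allFin)
open import Data.List.Properties using (map-++; map-∘; map-cong)
open import Data.List.Relation.Unary.All using (lookup)
open import Data.Nat using (ℕ; zero; suc; _+_; _*_; _^_; _≤_; _<_; _∸_; z≤n; s≤s)
open import Data.Nat.Induction using (<-wellFounded)
open import Data.Nat.ListAction using (sum)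
open import Data.Nat.ListAction.Properties using (sum-++)
open import Data.Nat.Properties
  using ( ≤-refl; ≤-reflexive; ≤-antisym; ≤-total; <-irrefl; <-≤-trans; ≮⇒≥
        ; m<1+n⇒m<n∨m≡n; m≤m+n; m+[n∸m]≡n; +-comm; +-suc; +-identityʳ
        ; *-comm; *-identityˡ; *-identityʳ; *-zeroʳ; *-distribˡ-+; *-distribʳ-+
        ; +-mono-≤; +-monoʳ-≤; *-monoˡ-≤; *-monoʳ-≤; +-cancelʳ-≤; *-cancelˡ-≤
        ; +-commutativeSemigroup; *-commutativeSemigroup; module ≤-Reasoning )
open import Algebra.Properties.CommutativeSemigroup +-commutativeSemigroup
  using (interchange)
open import Algebra.Properties.CommutativeSemigroup *-commutativeSemigroup
  using (xy∙z≈xz∙y)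
open import Data.Nat.Tactic.RingSolver using (solve-∀)
open import Data.Product using (∃; _×_; _,_; proj₁; proj₂)
open import Data.Sum using ([_,_]′)
open import Data.Unit using (tt)
open import Function using (_∘_; _⇔_; mk⇔; Equivalence)
open import Induction.WellFounded using (Acc; acc)
open import Relation.Binary.PropositionalEquality
  using (_≡_; _≢_; refl; sym; trans; cong; subst; subst₂; module ≡-Reasoning)
open import Relation.Nullary using (¬_; Dec; yes; no; contradiction)
open import Relation.Nullary.Decidable using (T?; _×-dec_)
open import Relation.Unary using (Decidable)

open Equivalence using (to; from)

2*m*n≤m*m+n*n : ∀ m n → 2 * (m * n) ≤ m * m + n * n
2*m*n≤m*m+n*n m n = [ ordered , swapped ]′ (≤-total m n)
  where
  ordered : ∀ {m n} → m ≤ n → 2 * (m * n) ≤ m * m + n * n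
  ordered {m} {n} m≤n =
    subst (λ n → 2 * (m * n) ≤ m * m + n * n) (m+[n∸m]≡n m≤n)
      (subst (2 * (m * (m + c)) ≤_) (square m c) (m≤m+n _ (c * c)))
    where
    c : ℕ
    c = n ∸ m
    square : ∀ m c → 2 * (m * (m + c)) + c * c ≡ m * m + (m + c) * (m + c)
    square = solve-∀
  swapped : n ≤ m → 2 * (m * n) ≤ m * m + n * n
  swapped n≤m = subst₂ _≤_ (cong (2 *_) (*-comm n m)) (+-comm (n * n) (m * m)) (ordered n≤m)

am-gm : ∀ j a b → suc j * (a ^ j * b) ≤ j * a ^ suc j + b ^ suc j
am-gm zero    a b = ≤-reflexive (base a b)
  where
  base : ∀ a b → 1 * (1 * b) ≡ 0 * (a * 1) + b * 1
  base = solve-∀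
am-gm (suc j) a b = +-cancelʳ-≤ (j * (a * A * b)) _ _ (begin
  (2 + j) * (a * A * b) + j * (a * A * b)                 ≡⟨ e₁ j a b A ⟩
  (1 + j) * A * (2 * (a * b))                             ≤⟨ *-monoʳ-≤ ((1 + j) * A) (2*m*n≤m*m+n*n a b) ⟩
  (1 + j) * A * (a * a + b * b)                           ≡⟨ e₂ j a b A ⟩
  (1 + j) * (a * (a * A)) + (1 + j) * (A * b) * b         ≤⟨ +-monoʳ-≤ _ (*-monoˡ-≤ b (am-gm j a b)) ⟩
  (1 + j) * (a * (a * A)) + (j * (a * A) + b * B) * b     ≡⟨ e₃ j a b A B ⟩
  (1 + j) * (a * (a * A)) + b * (b * B) + j * (a * A * b) ∎)
  where
  open ≤-Reasoning
  A B : ℕ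
  A = a ^ j
  B = b ^ j
  e₁ : ∀ j a b A → (2 + j) * (a * A * b) + j * (a * A * b) ≡ (1 + j) * A * (2 * (a * b))
  e₁ = solve-∀
  e₂ : ∀ j a b A → (1 + j) * A * (a * a + b * b) ≡ (1 + j) * (a * (a * A)) + (1 + j) * (A * b) * b
  e₂ = solve-∀
  e₃ : ∀ j a b A B → (1 + j) * (a * (a * A)) + (j * (a * A) + b * B) * b
                   ≡ (1 + j) * (a * (a * A)) + b * (b * B) + j * (a * A * b)
  e₃ = solve-∀

-- Finite sums

infix 5 ∑
∑ : ∀ {a} {A : Set a} → List A → (A → ℕ) → ℕ
∑ xs f = sum (map f xs)
syntax ∑ xs (λ x → e) = ∑[ x ∈ xs ] e

module _ {a} {A : Set a} where

  ∑-cong : ∀ {f g : A → ℕ} → (∀ x → f x ≡ g x) → ∀ xs → ∑ xs f ≡ ∑ xs g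
  ∑-cong f≗g xs = cong sum (map-cong f≗g xs)

  ∑-mono-≤ : ∀ {f g : A → ℕ} → (∀ x → f x ≤ g x) → ∀ xs → ∑ xs f ≤ ∑ xs g
  ∑-mono-≤ f≤g []       = z≤n
  ∑-mono-≤ f≤g (x ∷ xs) = +-mono-≤ (f≤g x) (∑-mono-≤ f≤g xs)

  ∑-zero : ∀ (xs : List A) → ∑[ x ∈ xs ] 0 ≡ 0
  ∑-zero []       = refl
  ∑-zero (x ∷ xs) = ∑-zero xs

  ∑-distrib-+ : ∀ (f g : A → ℕ) xs → ∑[ x ∈ xs ] f x + g x ≡ ∑ xs f + ∑ xs g
  ∑-distrib-+ f g []       = refl
  ∑-distrib-+ f g (x ∷ xs) =
    trans (cong (f x + g x +_) (∑-distrib-+ f g xs)) (interchange (f x) (g x) _ _)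

  *-distribˡ-∑ : ∀ c (f : A → ℕ) xs → c * ∑ xs f ≡ ∑[ x ∈ xs ] c * f x
  *-distribˡ-∑ c f []       = *-zeroʳ c
  *-distribˡ-∑ c f (x ∷ xs) =
    trans (*-distribˡ-+ c (f x) _) (cong (c * f x +_) (*-distribˡ-∑ c f xs))

  *-distribʳ-∑ : ∀ c (f : A → ℕ) xs → ∑ xs f * c ≡ ∑[ x ∈ xs ] f x * c
  *-distribʳ-∑ c f []       = refl
  *-distribʳ-∑ c f (x ∷ xs) =
    trans (*-distribʳ-+ c (f x) _) (cong (f x * c +_) (*-distribʳ-∑ c f xs))

  ∑-map : ∀ {b} {B : Set b} (g : A → B) (f : B → ℕ) xs → ∑ (map g xs) f ≡ ∑ xs (f ∘ g)
  ∑-map g f xs = cong sum (sym (map-∘ xs))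

  ∑-concatMap : ∀ {b} {B : Set b} (g : A → List B) (f : B → ℕ) xs →
                ∑ (concatMap g xs) f ≡ ∑[ x ∈ xs ] ∑ (g x) f
  ∑-concatMap g f []       = refl
  ∑-concatMap g f (x ∷ xs) = begin
    sum (map f (g x ++ concatMap g xs))   ≡⟨ cong sum (map-++ f (g x) _) ⟩
    sum (map f (g x) ++ map f (concatMap g xs)) ≡⟨ sum-++ (map f (g x)) _ ⟩
    ∑ (g x) f + ∑ (concatMap g xs) f              ≡⟨ cong (∑ (g x) f +_) (∑-concatMap g f xs) ⟩
    ∑ (g x) f + (∑[ y ∈ xs ] ∑ (g y) f)           ∎
    where open ≡-Reasoning

∑-comm : ∀ {a b} {A : Set a} {B : Set b} (f : A → B → ℕ) xs ys →
         ∑[ x ∈ xs ] ∑[ y ∈ ys ] f x y ≡ ∑[ y ∈ ys ] ∑[ x ∈ xs ] f x y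
∑-comm f []       ys = sym (∑-zero ys)
∑-comm f (x ∷ xs) ys =
  trans (cong (∑ ys (f x) +_) (∑-comm f xs ys)) (sym (∑-distrib-+ (f x) _ ys))

χ : Bool → ℕ
χ true  = 1
χ false = 0

χ-∧ : ∀ a b → χ (a ∧ b) ≡ χ a * χ b
χ-∧ true  b = sym (+-identityʳ (χ b))
χ-∧ false b = refl

χ-mono : ∀ {a b} → (T a → T b) → χ a ≤ χ b
χ-mono {false}         _   = z≤n
χ-mono {true} {true}   _   = ≤-refl
χ-mono {true} {false} a⇒b = contradiction tt a⇒b

χ≤1 : ∀ b → χ b ≤ 1
χ≤1 b = χ-mono {b} {true} _

χ-cong : ∀ {a b} → (T a → T b) → (T b → T a) → χ a ≡ χ b
χ-cong a⇒b b⇒a = ≤-antisym (χ-mono a⇒b) (χ-mono b⇒a)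

length-filter≡∑χ : ∀ {a} {A : Set a} (p : A → Bool) (p? : ∀ x → Dec (T (p x))) xs →
                   length (filter p? xs) ≡ ∑[ x ∈ xs ] χ (p x)
length-filter≡∑χ p p? []       = refl
length-filter≡∑χ p p? (x ∷ xs) with p x | p? x
... | true  | yes _  = cong suc (length-filter≡∑χ p p? xs)
... | false | no _   = length-filter≡∑χ p p? xs
... | true  | no ¬t  = contradiction tt ¬t
... | false | yes ()

∑-allMaps-extend : ∀ {n m} (w : (Fin (suc n) → Fin m) → ℕ) →
  ∑ (allMaps (suc n) m) w ≡ ∑[ a ∈ allFins m ] ∑[ g ∈ allMaps n m ] w (extend a g)
∑-allMaps-extend {n} {m} w =
  trans (∑-concatMap _ w (allFins m)) (∑-cong (λ a → ∑-map (extend a) w (allMaps n m)) (allFins m))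

-- Defined through extend, rather than as Data.Vec.Functional.insertAt, so that sums over
-- allMaps unfold definitionally along it.
extendAt : ∀ {n m} → Fin (suc n) → Fin m → (Fin n → Fin m) → Fin (suc n) → Fin m
extendAt         zero    a g = extend a g
extendAt {suc n} (suc ℓ) a g = extend (g zero) (extendAt ℓ a (g ∘ suc))

extendAt-self : ∀ {n m} (ℓ : Fin (suc n)) (a : Fin m) g → extendAt ℓ a g ℓ ≡ a
extendAt-self         zero    a g = refl
extendAt-self {suc n} (suc ℓ) a g = extendAt-self ℓ a (g ∘ suc)

extendAt-punchIn : ∀ {n m} (ℓ : Fin (suc n)) (a : Fin m) g i → extendAt ℓ a g (punchIn ℓ i) ≡ g i
extendAt-punchIn         zero    a g i       = refl
extendAt-punchIn {suc n} (suc ℓ) a g zero    = refl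
extendAt-punchIn {suc n} (suc ℓ) a g (suc i) = extendAt-punchIn ℓ a (g ∘ suc) i

∑-allMaps-extendAt : ∀ {n m} (ℓ : Fin (suc n)) (w : (Fin (suc n) → Fin m) → ℕ) →
  ∑ (allMaps (suc n) m) w ≡ ∑[ a ∈ allFins m ] ∑[ g ∈ allMaps n m ] w (extendAt ℓ a g)
∑-allMaps-extendAt zero w = ∑-allMaps-extend w
∑-allMaps-extendAt {suc n} {m} (suc ℓ) w = begin
  ∑ (allMaps (suc (suc n)) m) w
    ≡⟨ ∑-allMaps-extend w ⟩
  ∑[ b ∈ allFins m ] ∑[ h ∈ allMaps (suc n) m ] w (extend b h)
    ≡⟨ ∑-cong (λ b → ∑-allMaps-extendAt ℓ (w ∘ extend b)) (allFins m) ⟩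
  ∑[ b ∈ allFins m ] ∑[ a ∈ allFins m ] ∑[ g ∈ allMaps n m ] w (extend b (extendAt ℓ a g))
    ≡⟨ ∑-comm _ (allFins m) (allFins m) ⟩
  ∑[ a ∈ allFins m ] ∑[ b ∈ allFins m ] ∑[ g ∈ allMaps n m ] w (extend b (extendAt ℓ a g))
    ≡⟨ ∑-cong (λ a → sym (∑-allMaps-extend (w ∘ extendAt (suc ℓ) a))) (allFins m) ⟩
  ∑[ a ∈ allFins m ] ∑[ g ∈ allMaps (suc n) m ] w (extendAt (suc ℓ) a g) ∎
  where open ≡-Reasoning

∑-allMaps-allB : ∀ k {m} (p : Fin m → Bool) →
  ∑[ g ∈ allMaps k m ] χ (allB (p ∘ g)) ≡ (∑[ a ∈ allFins m ] χ (p a)) ^ k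
∑-allMaps-allB zero    p = refl
∑-allMaps-allB (suc k) {m} p = begin
  ∑[ g ∈ allMaps (suc k) m ] χ (allB (p ∘ g))
    ≡⟨ ∑-allMaps-extend (λ g → χ (allB (p ∘ g))) ⟩
  ∑[ a ∈ allFins m ] ∑[ g ∈ allMaps k m ] χ (p a ∧ allB (p ∘ g))
    ≡⟨ ∑-cong (λ a → ∑-cong (λ g → χ-∧ (p a) _) (allMaps k m)) (allFins m) ⟩
  ∑[ a ∈ allFins m ] ∑[ g ∈ allMaps k m ] χ (p a) * χ (allB (p ∘ g))
    ≡⟨ ∑-cong (λ a → sym (*-distribˡ-∑ (χ (p a)) _ (allMaps k m))) (allFins m) ⟩
  ∑[ a ∈ allFins m ] χ (p a) * (∑[ g ∈ allMaps k m ] χ (allB (p ∘ g)))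
    ≡⟨ ∑-cong (λ a → cong (χ (p a) *_) (∑-allMaps-allB k p)) (allFins m) ⟩
  ∑[ a ∈ allFins m ] χ (p a) * S ^ k
    ≡⟨ sym (*-distribʳ-∑ (S ^ k) (χ ∘ p) (allFins m)) ⟩
  S * S ^ k ∎
  where
  open ≡-Reasoning
  S : ℕ
  S = ∑[ a ∈ allFins m ] χ (p a)

T-allB : ∀ {n} (p : Fin n → Bool) → T (allB p) ⇔ (∀ i → T (p i))
T-allB {zero}  p = mk⇔ (λ _ ()) (λ _ → tt)
T-allB {suc n} p = mk⇔ allB⇒ ⇒allB
  where
  allB⇒ : T (allB p) → ∀ i → T (p i)
  allB⇒ t zero    = proj₁ (to T-∧ t)
  allB⇒ t (suc i) = to (T-allB (p ∘ suc)) (proj₂ (to T-∧ t)) i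
  ⇒allB : (∀ i → T (p i)) → T (allB p)
  ⇒allB h = from T-∧ (h zero , from (T-allB (p ∘ suc)) (h ∘ suc))

T-implB : ∀ {a b} → T (implB a b) ⇔ (T a → T b)
T-implB {false} = mk⇔ (λ _ ()) (λ _ → tt)
T-implB {true}  = mk⇔ (λ t _ → t) (λ f → f tt)

T-isHomB : ∀ {n m} (G : Graph n) (H : Graph m) f → T (isHomB G H f) ⇔ IsHom G H f
T-isHomB G H f = mk⇔
  (λ t u v → to T-implB (to (T-allB _) (to (T-allB _) t u) v))
  (λ hom → from (T-allB _) (λ u → from (T-allB _) (λ v → from T-implB (hom u v))))

homCount≡∑χ : ∀ {n m} (G : Graph n) (H : Graph m) →
              homCount G H ≡ ∑[ f ∈ allMaps n m ] χ (isHomB G H f)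
homCount≡∑χ {n} {m} G H = length-filter≡∑χ (isHomB G H) _ (allMaps n m)

Edge-sym : ∀ {n} (G : Graph n) {u v} → Edge G u v → Edge G v u
Edge-sym G {u} {v} = subst T (Graph.sym G u v)

Edge⇒≢ : ∀ {n} (G : Graph n) {u v} → Edge G u v → u ≢ v
Edge⇒≢ G {u} e refl = subst T (irref G u) e

module _ {n} {G : Graph n} where

  infixr 5 _++ʷ_
  _++ʷ_ : ∀ {u v w} → Walk G u v → Walk G v w → Walk G u w
  here     ++ʷ q = q
  step e p ++ʷ q = step e (p ++ʷ q)

  reverseʷ : ∀ {u v} → Walk G u v → Walk G v u
  reverseʷ here       = here
  reverseʷ (step e p) = reverseʷ p ++ʷ step (Edge-sym G e) here

  walksTo⇒connected : ∀ {x} → (∀ v → Walk G v x) → Connected G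
  walksTo⇒connected to-x u v = to-x u ++ʷ reverseʷ (to-x v)

removeVertex : ∀ {n} → Graph (suc n) → Fin (suc n) → Graph n
removeVertex G ℓ = record
  { adj   = λ u v → adj G (punchIn ℓ u) (punchIn ℓ v)
  ; sym   = λ u v → Graph.sym G (punchIn ℓ u) (punchIn ℓ v)
  ; irref = λ u → irref G (punchIn ℓ u)
  }

removeVertex-Edge : ∀ {n} (G : Graph (suc n)) {ℓ u v} (ℓ≢u : ℓ ≢ u) (ℓ≢v : ℓ ≢ v) →
                    Edge G u v → Edge (removeVertex G ℓ) (punchOut ℓ≢u) (punchOut ℓ≢v)
removeVertex-Edge G ℓ≢u ℓ≢v =
  subst₂ (Edge G) (sym (punchIn-punchOut ℓ≢u)) (sym (punchIn-punchOut ℓ≢v))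

-- A removable vertex

minimal : ∀ {p} {P : ℕ → Set p} → Decidable P → ∀ {n} → P n →
          ∃ λ m → P m × (∀ {k} → k < m → ¬ P k)
minimal {P = P} P? {n} Pn = search 0 n (λ ()) (subst P (sym (+-identityʳ n)) Pn)
  where
  search : ∀ i fuel → (∀ {k} → k < i → ¬ P k) → P (fuel + i) →
           ∃ λ m → P m × (∀ {k} → k < m → ¬ P k)
  search i zero        below Pi = i , Pi , below
  search i (suc fuel) below P[1+fuel+i] with P? i
  ... | yes Pi  = i , Pi , below
  ... | no  ¬Pi = search (suc i) fuel below′ (subst P (sym (+-suc fuel i)) P[1+fuel+i])
    where
    below′ : ∀ {k} → k < suc i → ¬ P k
    below′ k<1+i = [ below , (λ { refl → ¬Pi }) ]′ (m<1+n⇒m<n∨m≡n k<1+i)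

module _ {n} (G : Graph n) (x : Fin n) where

  ReachIn : ℕ → Fin n → Set
  ReachIn zero    v = v ≡ x
  ReachIn (suc k) v = ∃ λ u → Edge G v u × ReachIn k u

  reachIn? : ∀ k → Decidable (ReachIn k)
  reachIn? zero    v = v ≟ x
  reachIn? (suc k) v = any? (λ u → T? (adj G v u) ×-dec reachIn? k u)

  walk⇒reachIn : ∀ {v} → Walk G v x → ∃ λ k → ReachIn k v
  walk⇒reachIn here       = 0 , refl
  walk⇒reachIn (step e p) = let k , r = walk⇒reachIn p in suc k , _ , e , r

  Descent : (Fin n → ℕ) → Set
  Descent d = ∀ v → v ≢ x → ∃ λ u → Edge G v u × d u < d v

  distance-descent : (∀ v → Walk G v x) → ∃ Descent
  distance-descent to-x = distance , descends
    where
    shortest : ∀ v → ∃ λ k → ReachIn k v × (∀ {j} → j < k → ¬ ReachIn j v)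
    shortest v = minimal (λ k → reachIn? k v) (proj₂ (walk⇒reachIn (to-x v)))
    distance : Fin n → ℕ
    distance v = proj₁ (shortest v)
    descends : Descent distance
    descends v v≢x with shortest v
    ... | zero  , v≡x , _ = contradiction v≡x v≢x
    ... | suc k , (u , v~u , r) , _ =
      u , v~u , s≤s (≮⇒≥ (λ k<du → proj₂ (proj₂ (shortest u)) k<du r))

-- Following the descent from any vertex never reaches ℓ: each step lowers d, and d is
-- maximal at ℓ away from x.
descent⇒removeVertex-connected :
  ∀ {n} {G : Graph (suc n)} {x} d → Descent G x d →
  ∀ {ℓ} → ℓ ≢ x → (∀ v → v ≢ x → d v ≤ d ℓ) → Connected (removeVertex G ℓ)
descent⇒removeVertex-connected {n} {G} {x} d descends {ℓ} ℓ≢x ℓ-max =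
  walksTo⇒connected λ v → subst (λ y → Walk G′ y x′) (punchOut-punchIn ℓ)
    (walk (punchIn ℓ v) (punchInᵢ≢i ℓ v ∘ sym) (<-wellFounded _))
  where
  G′ : Graph n
  G′ = removeVertex G ℓ
  x′ : Fin n
  x′ = punchOut ℓ≢x
  walk : ∀ v (ℓ≢v : ℓ ≢ v) → Acc _<_ (d v) → Walk G′ (punchOut ℓ≢v) x′
  walk v ℓ≢v (acc rs) with v ≟ x
  ... | yes refl = subst (λ y → Walk G′ y x′) (punchOut-cong ℓ refl) here
  ... | no v≢x with descends v v≢x
  ...   | u , v~u , du<dv = step (removeVertex-Edge G ℓ≢v ℓ≢u v~u) (walk u ℓ≢u (rs du<dv))
    where
    ℓ≢u : ℓ ≢ u
    ℓ≢u refl = <-irrefl refl (<-≤-trans du<dv (ℓ-max v v≢x))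

record RemovableVertex {n} (G : Graph (suc (suc n))) (x : Fin (suc (suc n))) : Set where
  field
    vertex    : Fin (suc (suc n))
    vertex≢x  : vertex ≢ x
    neighbour : Fin (suc n)
    adjacent  : Edge G vertex (punchIn vertex neighbour)
    connected : Connected (removeVertex G vertex)

descent⇒removableVertex : ∀ {n} {G : Graph (suc (suc n))} {x} d → Descent G x d →
                          RemovableVertex G x
descent⇒removableVertex {n} {G} {x} d descends = record
  { vertex    = ℓ
  ; vertex≢x  = ℓ≢x
  ; neighbour = punchOut ℓ≢u
  ; adjacent  = subst (Edge G ℓ) (sym (punchIn-punchOut ℓ≢u)) ℓ~u
  ; connected = descent⇒removeVertex-connected {G = G} d descends ℓ≢x ℓ-max
  }
  where
  farthest : Fin (suc n)
  farthest = argmax (d ∘ punchIn x) zero (allFin (suc n))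
  ℓ : Fin (suc (suc n))
  ℓ = punchIn x farthest
  ℓ≢x : ℓ ≢ x
  ℓ≢x = punchInᵢ≢i x farthest
  ℓ-max : ∀ v → v ≢ x → d v ≤ d ℓ
  ℓ-max v v≢x = subst (λ w → d w ≤ d ℓ) (punchIn-punchOut (v≢x ∘ sym))
    (lookup (f[xs]≤f[argmax] {f = d ∘ punchIn x} zero (allFin (suc n))) (∈-allFin _))
  u : Fin (suc (suc n))
  u = proj₁ (descends ℓ ℓ≢x)
  ℓ~u : Edge G ℓ u
  ℓ~u = proj₁ (proj₂ (descends ℓ ℓ≢x))
  ℓ≢u : ℓ ≢ u
  ℓ≢u = Edge⇒≢ G ℓ~u

removableVertex : ∀ {n} {G : Graph (suc (suc n))} → Connected G → ∀ x → RemovableVertex G x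
removableVertex {G = G} conn x with distance-descent G x (λ v → conn v x)
... | d , descends = descent⇒removableVertex d descends

-- Degree moments of homomorphisms

module _ {m} (H : Graph m) where

  degree : Fin m → ℕ
  degree v = ∑[ u ∈ allFins m ] χ (adj H v u)

  homMoment : ∀ {n} → Graph n → Fin n → ℕ → ℕ
  homMoment {n} G x j = ∑[ f ∈ allMaps n m ] χ (isHomB G H f) * degree (f x) ^ j

  isHomB-extendAt : ∀ {n} (G : Graph (suc n)) ℓ {p} → Edge G ℓ (punchIn ℓ p) → ∀ a g →
    T (isHomB G H (extendAt ℓ a g)) → T (isHomB (removeVertex G ℓ) H g ∧ adj H (g p) a)
  isHomB-extendAt G ℓ {p} ℓ~p a g t =
    from T-∧ (from (T-isHomB (removeVertex G ℓ) H g) restricted , gp~a)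
    where
    hom : IsHom G H (extendAt ℓ a g)
    hom = to (T-isHomB G H (extendAt ℓ a g)) t
    restricted : IsHom (removeVertex G ℓ) H g
    restricted u v e = subst₂ (Edge H) (extendAt-punchIn ℓ a g u) (extendAt-punchIn ℓ a g v)
      (hom (punchIn ℓ u) (punchIn ℓ v) e)
    gp~a : Edge H (g p) a
    gp~a = subst₂ (Edge H) (extendAt-punchIn ℓ a g p) (extendAt-self ℓ a g)
      (hom (punchIn ℓ p) ℓ (Edge-sym G ℓ~p))

  homMoment-removeVertex : ∀ {n} (G : Graph (suc n)) ℓ {p} → Edge G ℓ (punchIn ℓ p) → ∀ x j →
    homMoment G (punchIn ℓ x) j ≤
    ∑[ g ∈ allMaps n m ] χ (isHomB (removeVertex G ℓ) H g) * degree (g x) ^ j * degree (g p)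
  homMoment-removeVertex {n} G ℓ {p} ℓ~p x j = begin
    homMoment G (punchIn ℓ x) j
      ≡⟨ ∑-allMaps-extendAt ℓ (λ f → χ (isHomB G H f) * degree (f (punchIn ℓ x)) ^ j) ⟩
    ∑[ a ∈ allFins m ] ∑[ g ∈ allMaps n m ]
      χ (isHomB G H (extendAt ℓ a g)) * degree (extendAt ℓ a g (punchIn ℓ x)) ^ j
      ≤⟨ ∑-mono-≤ (λ a → ∑-mono-≤ (restrict a) (allMaps n m)) (allFins m) ⟩
    ∑[ a ∈ allFins m ] ∑[ g ∈ allMaps n m ] c g * χ (adj H (g p) a)
      ≡⟨ ∑-comm _ (allFins m) (allMaps n m) ⟩
    ∑[ g ∈ allMaps n m ] ∑[ a ∈ allFins m ] c g * χ (adj H (g p) a)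
      ≡⟨ ∑-cong (λ g → sym (*-distribˡ-∑ (c g) _ (allFins m))) (allMaps n m) ⟩
    ∑[ g ∈ allMaps n m ] c g * degree (g p) ∎
    where
    open ≤-Reasoning
    G′ : Graph n
    G′ = removeVertex G ℓ
    c : (Fin n → Fin m) → ℕ
    c g = χ (isHomB G′ H g) * degree (g x) ^ j
    restrict : ∀ a g → χ (isHomB G H (extendAt ℓ a g)) * degree (extendAt ℓ a g (punchIn ℓ x)) ^ j
                       ≤ c g * χ (adj H (g p) a)
    restrict a g rewrite extendAt-punchIn ℓ a g x = begin
      χ (isHomB G H (extendAt ℓ a g)) * degree (g x) ^ j
        ≤⟨ *-monoˡ-≤ _ (χ-mono (isHomB-extendAt G ℓ ℓ~p a g)) ⟩
      χ (isHomB G′ H g ∧ adj H (g p) a) * degree (g x) ^ j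
        ≡⟨ cong (_* degree (g x) ^ j) (χ-∧ (isHomB G′ H g) _) ⟩
      χ (isHomB G′ H g) * χ (adj H (g p) a) * degree (g x) ^ j
        ≡⟨ xy∙z≈xz∙y (χ (isHomB G′ H g)) _ (degree (g x) ^ j) ⟩
      c g * χ (adj H (g p) a) ∎

  homMoment-am-gm : ∀ {n} (G : Graph n) x p j →
    suc j * (∑[ f ∈ allMaps n m ] χ (isHomB G H f) * degree (f x) ^ j * degree (f p)) ≤
    j * homMoment G x (suc j) + homMoment G p (suc j)
  homMoment-am-gm {n} G x p j = begin
    suc j * (∑[ f ∈ allMaps n m ] χ (isHomB G H f) * degree (f x) ^ j * degree (f p))
      ≡⟨ *-distribˡ-∑ (suc j) _ (allMaps n m) ⟩
    ∑[ f ∈ allMaps n m ] suc j * (χ (isHomB G H f) * degree (f x) ^ j * degree (f p))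
      ≤⟨ ∑-mono-≤ (λ f → scaled-am-gm (χ (isHomB G H f)) (degree (f x)) (degree (f p))) (allMaps n m) ⟩
    ∑[ f ∈ allMaps n m ] (j * (χ (isHomB G H f) * degree (f x) ^ suc j)
                          + χ (isHomB G H f) * degree (f p) ^ suc j)
      ≡⟨ ∑-distrib-+ _ _ (allMaps n m) ⟩
    (∑[ f ∈ allMaps n m ] j * (χ (isHomB G H f) * degree (f x) ^ suc j)) + homMoment G p (suc j)
      ≡⟨ cong (_+ homMoment G p (suc j)) (sym (*-distribˡ-∑ j _ (allMaps n m))) ⟩
    j * homMoment G x (suc j) + homMoment G p (suc j) ∎
    where
    open ≤-Reasoning
    scaled-am-gm : ∀ c a b → suc j * (c * a ^ j * b) ≤ j * (c * a ^ suc j) + c * b ^ suc j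
    scaled-am-gm c a b = subst₂ _≤_ (e₁ j c (a ^ j) b) (e₂ j c (a ^ suc j) (b ^ suc j))
      (*-monoʳ-≤ c (am-gm j a b))
      where
      e₁ : ∀ j c A b → c * ((1 + j) * (A * b)) ≡ (1 + j) * (c * A * b)
      e₁ = solve-∀
      e₂ : ∀ j c A B → c * (j * A + B) ≡ j * (c * A) + c * B
      e₂ = solve-∀

  homMoment≤∑degree^ : ∀ k (G : Graph (suc k)) → Connected G → ∀ x j →
    homMoment G x j ≤ ∑[ v ∈ allFins m ] degree v ^ (k + j)
  homMoment≤∑degree^ zero G _ zero j = begin
    homMoment G zero j
      ≤⟨ ∑-mono-≤ (λ f → *-monoˡ-≤ (degree (f zero) ^ j) (χ≤1 (isHomB G H f))) (allMaps 1 m) ⟩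
    ∑[ f ∈ allMaps 1 m ] 1 * degree (f zero) ^ j
      ≡⟨ ∑-allMaps-extend (λ f → 1 * degree (f zero) ^ j) ⟩
    ∑[ a ∈ allFins m ] ∑[ g ∈ allMaps 0 m ] 1 * degree a ^ j
      ≡⟨ ∑-cong (λ a → trans (+-identityʳ _) (*-identityˡ _)) (allFins m) ⟩
    ∑[ a ∈ allFins m ] degree a ^ j ∎
    where open ≤-Reasoning
  homMoment≤∑degree^ (suc k) G conn x j = *-cancelˡ-≤ (suc j) (begin
    suc j * homMoment G x j
      ≡⟨ cong (λ y → suc j * homMoment G y j) (sym (punchIn-punchOut vertex≢x)) ⟩
    suc j * homMoment G (punchIn vertex x′) j
      ≤⟨ *-monoʳ-≤ (suc j) (homMoment-removeVertex G vertex adjacent x′ j) ⟩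
    suc j * (∑[ g ∈ allMaps (suc k) m ] χ (isHomB G′ H g) * degree (g x′) ^ j * degree (g neighbour))
      ≤⟨ homMoment-am-gm G′ x′ neighbour j ⟩
    j * homMoment G′ x′ (suc j) + homMoment G′ neighbour (suc j)
      ≤⟨ +-mono-≤ (*-monoʳ-≤ j (induction x′)) (induction neighbour) ⟩
    j * S + S
      ≡⟨ +-comm (j * S) S ⟩
    suc j * S
      ≡⟨ cong (λ e → suc j * (∑[ v ∈ allFins m ] degree v ^ e)) (+-suc k j) ⟩
    suc j * (∑[ v ∈ allFins m ] degree v ^ (suc k + j)) ∎)
    where
    open ≤-Reasoning
    open RemovableVertex (removableVertex conn x)
    G′ : Graph (suc k)
    G′ = removeVertex G vertex
    x′ : Fin (suc k)
    x′ = punchOut vertex≢x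
    S : ℕ
    S = ∑[ v ∈ allFins m ] degree v ^ (k + suc j)
    induction : ∀ y → homMoment G′ y (suc j) ≤ S
    induction y = homMoment≤∑degree^ k G′ connected y (suc j)

  homCount-Star : ∀ k → homCount (Star k) H ≡ ∑[ v ∈ allFins m ] degree v ^ k
  homCount-Star k = begin
    homCount (Star k) H
      ≡⟨ homCount≡∑χ (Star k) H ⟩
    ∑[ f ∈ allMaps (suc k) m ] χ (isHomB (Star k) H f)
      ≡⟨ ∑-allMaps-extend (λ f → χ (isHomB (Star k) H f)) ⟩
    ∑[ a ∈ allFins m ] ∑[ g ∈ allMaps k m ] χ (isHomB (Star k) H (extend a g))
      ≡⟨ ∑-cong (λ a → ∑-cong (λ g → isHomB-Star a g) (allMaps k m)) (allFins m) ⟩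
    ∑[ a ∈ allFins m ] ∑[ g ∈ allMaps k m ] χ (allB (adj H a ∘ g))
      ≡⟨ ∑-cong (λ a → ∑-allMaps-allB k (adj H a)) (allFins m) ⟩
    ∑[ a ∈ allFins m ] degree a ^ k ∎
    where
    open ≡-Reasoning
    isHomB-Star : ∀ a g → χ (isHomB (Star k) H (extend a g)) ≡ χ (allB (adj H a ∘ g))
    isHomB-Star a g = χ-cong
      (λ t → from (T-allB _) (λ i → to (T-isHomB (Star k) H (extend a g)) t zero (suc i) tt))
      (λ t → from (T-isHomB (Star k) H (extend a g)) (star-hom (to (T-allB _) t)))
      where
      star-hom : (∀ i → Edge H a (g i)) → IsHom (Star k) H (extend a g)
      star-hom a~g zero    (suc i) _ = a~g i
      star-hom a~g (suc i) zero    _ = Edge-sym H (a~g i)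

theorem1 : (k : ℕ) (G : Graph (suc k)) → Connected G →
    ∀ {m} (H : Graph m) → homCount G H ≤ homCount (Star k) H
theorem1 k G conn {m} H = begin
  homCount G H                                   ≡⟨ homCount≡∑χ G H ⟩
  ∑[ f ∈ allMaps (suc k) m ] χ (isHomB G H f)    ≡⟨ ∑-cong (λ f → sym (*-identityʳ _)) (allMaps (suc k) m) ⟩
  homMoment H G zero 0                           ≤⟨ homMoment≤∑degree^ H k G conn zero 0 ⟩
  ∑[ v ∈ allFins m ] degree H v ^ (k + 0)        ≡⟨ cong (λ e → ∑[ v ∈ allFins m ] degree H v ^ e) (+-identityʳ k) ⟩
  ∑[ v ∈ allFins m ] degree H v ^ k              ≡⟨ homCount-Star H k ⟨
  homCount (Star k) H                            ∎
  where open ≤-Reasoning
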